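{- Let $k\ge4$, $G$, $\mathcal S$, $\mathcal Q$, $\alpha$ and the token assignment be as described in the context. Every $4^+$-star of $\mathcal S$ receives in total (summing over its vertices) at least $\frac{5(1-\alpha)}{2(k-1)}$ token.
   Context: $G=(V,E)$ is a simple undirected graph, $k\ge4$ an integer. A star in $G$ is a subgraph that is a single vertex, a single edge, or a tree with exactly one vertex of degree $\ge2$ and all others of degree $1$; an $\ell$-star has exactly $\ell$ vertices, an $\ell^-$-star at most $\ell$, an $\ell^+$-star at least $\ell$. The center of a star is its vertex of maximum degree (in a $2$-star one vertex is designated as center, arbitrarily but fixed); the others are satellites. A $k^-$-star partition of $G$ is a collection of vertex-disjoint $k^-$-stars covering $V$. Operations on a partition $\mathcal S$ (critical vertices are vertices in a $2$-star of $\mathcal S$ or centers of $3$-stars of $\mathcal S$; separate critical vertices lie in different stars of $\mathcal S$): Op.1: for $\{u,v\}\in E$ with $u$ in a $2$-star and $v$ a satellite of a $4^+$-star centered at $c$, replace $\{c,v\}$ by $\{u,v\}$. Op.2: for a star $v_1$-$v_2\ldots v_\ell$ of $\mathcal S$ ($\ell\in\{2,3,4\}$, center $v_1$) and pairwise separate critical vertices $w_1,\dots,w_\ell$ outside it with $\{v_j,w_j\}\in E$, replace its edges by $\{v_j,w_j\}$. Op.3: for a $2$- or $3$-star $S=v_1$-$v_2\ldots v_\ell$ and a $2$-star $W=w_1$-$w_2\neq S$ with $w_1,w_2$ adjacent to $v_1$: if $k\ge5$ or $\ell=2$ replace $\{w_1,w_2\}$ by $\{w_1,v_1\},\{w_2,v_1\}$;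 if $k=4,\ell=3$ and some critical $w_3\notin V(S)\cup V(W)$ is adjacent to $v_j$, $j\in\{2,3\}$, replace $\{w_1,w_2\},\{v_1,v_j\}$ by $\{w_1,v_1\},\{w_2,v_1\},\{w_3,v_j\}$. Standing assumptions: $\mathcal S$ is a $k^-$-star partition of $G$ with the minimum possible number of $1$-stars among all $k^-$-star partitions of $G$ and to which none of Operations 1–3 is applicable (equivalently, a possible output of the paper's algorithm). $\mathcal Q$ is a fixed optimal $k^-$-star partition (minimum number of stars), with a fixed center for each of its $2$-stars. "Critical" is always with respect to $\mathcal S$. Let $\alpha=\frac{2k-3}{2k^2-4k+1}$. Tokens: the vertex of each $1$-star of $\mathcal Q$ gets $\alpha$. For a $j$-star $v_1$-$v_2\ldots v_j$ of $\mathcal Q$ with $2\le j\le k$: (1) if $v_1$ is critical, $v_1$ gets $\alpha$ and each $v_i$ ($i\ge2$) gets $\frac{1-\alpha}{j-1}$; (2) if $v_1$ is not critical but some satellite is, each $v_i$ ($i\ge2$) gets $\alpha$ and $v_1$ gets $1-(j-1)\alpha$; (3) if no vertex of it is critical, each vertex gets $\frac1j$. A star of $\mathcal S$ receives the sum of the tokens of its vertices. -}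

module Defs where

open import Data.Nat as ℕ using (ℕ; zero; suc; _≤_; _∸_)
open import Data.Fin using (Fin; _≟_)
open import Data.List using (List; filter; length; foldr; map)
open import Data.Bool.ListAction using (any)
open import Data.List.Base using (allFin)
open import Data.Bool using (Bool; true; false; _∧_; _∨_; not; if_then_else_; T)
open import Data.Product using (Σ; _×_; Σ-syntax)
open import Data.Sum using (_⊎_)
open import Data.Integer using (+_)
open import Data.Rational using (ℚ; _/_; _+_; _*_; _-_; 0ℚ; 1ℚ)
open import Relation.Nullary using (¬_)
open import Relation.Nullary.Decidable using (⌊_⌋)
open import Relation.Binary.PropositionalEquality using (_≡_; _≢_)

record Graph (n : ℕ) : Set₁ where
  field
    Adj     : Fin n → Fin n → Set
    symm    : ∀ {u v} → Adj u v → Adj v u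
    irrefl  : ∀ {v} → ¬ Adj v v
open Graph public

-- A partition into stars is encoded by a map `ctr`
-- sending every vertex to the center of its star (centers are fixed
-- points; the designated center of a 2-star is its fixed point).
-- The star centered at x is { u | ctr u ≡ x } with edges {x,u}, u ≠ x.

classSize : ∀ {n} → (Fin n → Fin n) → Fin n → ℕ
classSize {n} c x = length (filter (λ u → c u ≟ x) (allFin n))

record StarPartition {n : ℕ} (k : ℕ) (G : Graph n) : Set where
  field
    ctr      : Fin n → Fin n
    ctr-idem : ∀ v → ctr (ctr v) ≡ ctr v
    ctr-adj  : ∀ v → ctr v ≢ v → Adj G v (ctr v)
    size-≤   : ∀ x → classSize ctr x ≤ k
open StarPartition public

module _ {n k : ℕ} {G : Graph n} (S : StarPartition k G) where

  size : Fin n → ℕ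
  size = classSize (ctr S)

  numStars : ℕ
  numStars = length (filter (λ x → ctr S x ≟ x) (allFin n))

  numOneStars : ℕ
  numOneStars = length (filter (λ x → size x ℕ.≟ 1) (allFin n))

  critical? : Fin n → Bool
  critical? v = ⌊ size (ctr S v) ℕ.≟ 2 ⌋ ∨ (⌊ ctr S v ≟ v ⌋ ∧ ⌊ size v ℕ.≟ 3 ⌋)

  Critical : Fin n → Set
  Critical v = T (critical? v)

  Op1Applicable : Set
  Op1Applicable = Σ[ u ∈ Fin n ] Σ[ v ∈ Fin n ] (Adj G u v × size (ctr S u) ≡ 2
                    × ctr S v ≢ v × 4 ≤ size (ctr S v))

  -- Operation 2 is applicable (star centered at x with ℓ = size x ∈ {2,3,4};
  -- w assigns to each vertex v_j of the star its partner w_j)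
  Op2Applicable : Set
  Op2Applicable = Σ[ x ∈ Fin n ] (ctr S x ≡ x × 2 ≤ size x × size x ≤ 4 ×
    Σ[ w ∈ (Fin n → Fin n) ] ((∀ v → ctr S v ≡ x → Critical (w v) × ctr S (w v) ≢ x × Adj G v (w v))
          × (∀ v v' → ctr S v ≡ x → ctr S v' ≡ x → v ≢ v' → ctr S (w v) ≢ ctr S (w v'))))

  -- Operation 3 is applicable (S centered at v1, W = w1-w2 centered at w1)
  Op3Applicable : Set
  Op3Applicable = Σ[ v1 ∈ Fin n ] Σ[ w1 ∈ Fin n ] Σ[ w2 ∈ Fin n ]
    ( ctr S v1 ≡ v1 × (size v1 ≡ 2 ⊎ size v1 ≡ 3)
    × ctr S w1 ≡ w1 × ctr S w2 ≡ w1 × w2 ≢ w1 × size w1 ≡ 2 × w1 ≢ v1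
    × Adj G w1 v1 × Adj G w2 v1
    × ((5 ≤ k ⊎ size v1 ≡ 2)
       ⊎ (k ≡ 4 × size v1 ≡ 3 ×
          Σ[ vj ∈ Fin n ] Σ[ w3 ∈ Fin n ] (ctr S vj ≡ v1 × vj ≢ v1 × Critical w3
                           × ctr S w3 ≢ v1 × ctr S w3 ≢ w1 × Adj G w3 vj))))

  NoOperationApplicable : Set
  NoOperationApplicable = ¬ Op1Applicable × ¬ Op2Applicable × ¬ Op3Applicable

MinOneStars : ∀ {n k} {G : Graph n} → StarPartition k G → Set
MinOneStars {k = k} {G} S = ∀ (S' : StarPartition k G) → numOneStars S ≤ numOneStars S'

Optimal : ∀ {n k} {G : Graph n} → StarPartition k G → Set
Optimal {k = k} {G} Q = ∀ (Q' : StarPartition k G) → numStars Q ≤ numStars Q'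

ℕtoℚ : ℕ → ℚ
ℕtoℚ m = + m / 1

-- inv m = 1/m  (and 0 for m = 0, never used)
inv : ℕ → ℚ
inv zero    = 0ℚ
inv (suc m) = + 1 / suc m

α : ℕ → ℚ
α k = + (2 ℕ.* k ∸ 3) / suc (2 ℕ.* k ℕ.* k ∸ 4 ℕ.* k)

module _ {n k : ℕ} {G : Graph n} (S Q : StarPartition k G) where

  satCritical? : Fin n → Bool
  satCritical? q = any (λ u → ⌊ ctr Q u ≟ q ⌋ ∧ not ⌊ u ≟ q ⌋ ∧ critical? S u) (allFin n)

  token : Fin n → ℚ
  token v with ctr Q v | size Q (ctr Q v)
  ... | q | j =
    if ⌊ j ℕ.≟ 1 ⌋ then α k
    else if critical? S q then
      (if ⌊ v ≟ q ⌋ then α k else (1ℚ - α k) * inv (j ∸ 1))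
    else if satCritical? q then
      (if ⌊ v ≟ q ⌋ then 1ℚ - ℕtoℚ (j ∸ 1) * α k else α k)
    else inv j

  starToken : Fin n → ℚ
  starToken x = foldr _+_ 0ℚ (map token (filter (λ u → ctr S u ≟ x) (allFin n)))

bound : ℕ → ℚ
bound k = (ℕtoℚ 5 * (1ℚ - α k)) * inv (2 ℕ.* (k ∸ 1))

{-# OPTIONS --safe #-}
-- Write h = (1 - α)/(2(k - 1)) = (k - 2)/(2k² - 4k + 1), so that the bound is 5h. Checking the three
-- token rules against the value of α, every vertex receives at least h, and at least 2h unless it is
-- the (non-critical) center of a Q-star with a critical satellite. Hence a star of S with at least
-- five vertices, or with a vertex receiving 2h, receives at least 5h. In the remaining case the star
-- has four vertices, each v with a critical Q-satellite w(v). The w(v) lie outside the star, whose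
-- vertices are not critical; by Op.1, w(v) for a satellite v is not in a 2-star, so it is the center
-- of a 3-star, and then the w(v) are pairwise separate: Op.2 would be applicable.
module Submission where

open import Defs
open import Data.Nat using (ℕ; _≤_)
open import Data.Rational using () renaming (_≤_ to _≤ℚ_)
open import Relation.Binary.PropositionalEquality using (_≡_)

open import Data.Nat as ℕ using (zero; suc; _∸_; z≤n; s≤s)
import Data.Nat.Properties as ℕ
open import Data.Nat.Tactic.RingSolver using (solve-∀)
open import Data.Integer as ℤ using (+_)
import Data.Integer.Properties as ℤ
open import Data.Rational using (ℚ; _/_; _+_; _*_; _-_; -_; 0ℚ; 1ℚ; toℚᵘ; fromℚᵘ; +-0-rawMonoid)
import Data.Rational.Properties as ℚ
open import Data.Rational.Unnormalised as ℚᵘ using (mkℚᵘ; *≤*; *≡*)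
import Data.Rational.Unnormalised.Properties as ℚᵘ
open import Algebra.Definitions.RawMonoid +-0-rawMonoid using () renaming (_×_ to _×ℚ_)
open import Data.Fin using (Fin; _≟_)
open import Data.Bool using (true; false; T; not; if_then_else_)
open import Data.Bool.Properties using (T-∧)
open import Data.List using (List; []; _∷_; filter; length; foldr; map; allFin)
open import Data.List.Membership.Propositional using (_∈_; lose)
open import Data.List.Membership.Propositional.Properties using (∈-filter⁺; ∈-allFin; ∈-length)
open import Data.List.Relation.Unary.Any using (Any; here; there; any?; satisfied)
open import Data.List.Relation.Unary.Any.Properties using (any⁻)
open import Data.Product using (Σ; Σ-syntax; _×_; _,_; proj₁; proj₂)
open import Data.Sum using (_⊎_; inj₁; inj₂; [_,_]′)
open import Data.Empty using (⊥-elim)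
open import Function.Base using (_∘_)
open import Function.Bundles using (Equivalence)
open import Relation.Nullary using (¬_; Dec; yes; no; contradiction)
open import Relation.Nullary.Decidable using (⌊_⌋; toWitness; toWitnessFalse)
open import Relation.Unary using (Decidable)
open import Relation.Binary.PropositionalEquality
  using (_≢_; refl; sym; trans; cong; cong₂; subst; subst₂; module ≡-Reasoning)

fromℚᵘ-homo-+ : ∀ p q → fromℚᵘ (p ℚᵘ.+ q) ≡ fromℚᵘ p + fromℚᵘ q
fromℚᵘ-homo-+ p q = ℚ.toℚᵘ-injective (begin-equality
  toℚᵘ (fromℚᵘ (p ℚᵘ.+ q))              ≃⟨ ℚ.toℚᵘ-fromℚᵘ (p ℚᵘ.+ q) ⟩
  p ℚᵘ.+ q                              ≃⟨ ℚᵘ.+-cong (ℚ.toℚᵘ-fromℚᵘ p) (ℚ.toℚᵘ-fromℚᵘ q) ⟨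
  toℚᵘ (fromℚᵘ p) ℚᵘ.+ toℚᵘ (fromℚᵘ q)  ≃⟨ ℚ.toℚᵘ-homo-+ (fromℚᵘ p) (fromℚᵘ q) ⟨
  toℚᵘ (fromℚᵘ p + fromℚᵘ q)            ∎)
  where open ℚᵘ.≤-Reasoning

fromℚᵘ-homo-* : ∀ p q → fromℚᵘ (p ℚᵘ.* q) ≡ fromℚᵘ p * fromℚᵘ q
fromℚᵘ-homo-* p q = ℚ.toℚᵘ-injective (begin-equality
  toℚᵘ (fromℚᵘ (p ℚᵘ.* q))              ≃⟨ ℚ.toℚᵘ-fromℚᵘ (p ℚᵘ.* q) ⟩
  p ℚᵘ.* q                              ≃⟨ ℚᵘ.*-cong (ℚ.toℚᵘ-fromℚᵘ p) (ℚ.toℚᵘ-fromℚᵘ q) ⟨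
  toℚᵘ (fromℚᵘ p) ℚᵘ.* toℚᵘ (fromℚᵘ q)  ≃⟨ ℚ.toℚᵘ-homo-* (fromℚᵘ p) (fromℚᵘ q) ⟨
  toℚᵘ (fromℚᵘ p * fromℚᵘ q)            ∎)
  where open ℚᵘ.≤-Reasoning

module _ (a b c d : ℕ) where

  /-+-/ : + a / suc b + + c / suc d ≡ + (a ℕ.* suc d ℕ.+ c ℕ.* suc b) / (suc b ℕ.* suc d)
  /-+-/ = trans (sym (fromℚᵘ-homo-+ (mkℚᵘ (+ a) b) (mkℚᵘ (+ c) d)))
    (ℚ./-cong (trans (cong₂ ℤ._+_ (sym (ℤ.pos-* a (suc d))) (sym (ℤ.pos-* c (suc b))))
                     (sym (ℤ.pos-+ (a ℕ.* suc d) (c ℕ.* suc b)))) refl)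

  /-*-/ : + a / suc b * (+ c / suc d) ≡ + (a ℕ.* c) / (suc b ℕ.* suc d)
  /-*-/ = trans (sym (fromℚᵘ-homo-* (mkℚᵘ (+ a) b) (mkℚᵘ (+ c) d)))
    (ℚ./-cong (sym (ℤ.pos-* a c)) refl)

  /-≡-cross : a ℕ.* suc d ≡ c ℕ.* suc b → + a / suc b ≡ + c / suc d
  /-≡-cross eq = ℚ.fromℚᵘ-cong {mkℚᵘ (+ a) b} {mkℚᵘ (+ c) d}
    (*≡* (subst₂ _≡_ (ℤ.pos-* a (suc d)) (ℤ.pos-* c (suc b)) (cong +_ eq)))

  /-≤-cross : a ℕ.* suc d ≤ c ℕ.* suc b → + a / suc b ≤ℚ + c / suc d
  /-≤-cross le = ℚ.toℚᵘ-cancel-≤ (ℚᵘ.≤-respˡ-≃ (ℚᵘ.≃-sym (ℚ.toℚᵘ-fromℚᵘ (mkℚᵘ (+ a) b)))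
    (ℚᵘ.≤-respʳ-≃ (ℚᵘ.≃-sym (ℚ.toℚᵘ-fromℚᵘ (mkℚᵘ (+ c) d)))
      (*≤* (subst₂ ℤ._≤_ (ℤ.pos-* a (suc d)) (ℤ.pos-* c (suc b)) (ℤ.+≤+ le)))))

/-+-same : ∀ a b c → + a / suc b + + c / suc b ≡ + (a ℕ.+ c) / suc b
/-+-same a b c = trans (/-+-/ a b c b)
  (/-≡-cross (a ℕ.* suc b ℕ.+ c ℕ.* suc b) (b ℕ.+ b ℕ.* suc b) (a ℕ.+ c) b (ring-eq a c (suc b)))
  where ring-eq : ∀ a c d → (a ℕ.* d ℕ.+ c ℕ.* d) ℕ.* d ≡ (a ℕ.+ c) ℕ.* (d ℕ.* d)
        ring-eq = solve-∀

×-/ : ∀ m a b → m ×ℚ (+ a / suc b) ≡ + (m ℕ.* a) / suc b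
×-/ zero    a b = /-≡-cross 0 0 0 b refl
×-/ (suc m) a b = trans (cong (_+_ (+ a / suc b)) (×-/ m a b)) (/-+-same a b (m ℕ.* a))

ℕtoℚ-*-/ : ∀ m a b → ℕtoℚ m * (+ a / suc b) ≡ + (m ℕ.* a) / suc b
ℕtoℚ-*-/ m a b = trans (/-*-/ m 0 a b)
  (/-≡-cross (m ℕ.* a) (b ℕ.+ 0) (m ℕ.* a) b (ring-eq (m ℕ.* a) (suc b)))
  where ring-eq : ∀ x d → x ℕ.* d ≡ x ℕ.* (1 ℕ.* d)
        ring-eq = solve-∀

/-*-inv : ∀ a b c {e} → suc c ℕ.* a ≡ e → + e / suc b * inv (suc c) ≡ + a / suc b
/-*-inv a b c refl =
  trans (/-*-/ (suc c ℕ.* a) b 1 c)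
    (/-≡-cross (suc c ℕ.* a ℕ.* 1) (c ℕ.+ b ℕ.* suc c) a b (ring-eq a (suc b) (suc c)))
  where ring-eq : ∀ a d c → (c ℕ.* a ℕ.* 1) ℕ.* d ≡ a ℕ.* (d ℕ.* c)
        ring-eq = solve-∀

inv-antimono : ∀ {i j} → 1 ≤ i → i ≤ j → inv j ≤ℚ inv i
inv-antimono {suc i} {suc j} _ i≤j = /-≤-cross 1 j 1 i (ℕ.*-monoʳ-≤ 1 i≤j)

+≡⇒-≡ : ∀ {x y z} → x + y ≡ z → z - y ≡ x
+≡⇒-≡ {x} {y} refl = begin
  (x + y) - y    ≡⟨ ℚ.+-assoc x y (- y) ⟩
  x + (y - y)    ≡⟨ cong (_+_ x) (ℚ.+-inverseʳ y) ⟩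
  x + 0ℚ         ≡⟨ ℚ.+-identityʳ x ⟩
  x              ∎
  where open ≡-Reasoning

+-≤⇒≤- : ∀ {x y z} → x + y ≤ℚ z → x ≤ℚ z - y
+-≤⇒≤- {x} {y} le = subst (_≤ℚ _) (+≡⇒-≡ refl) (ℚ.+-monoˡ-≤ (- y) le)

p≤p+q : ∀ {p q} → 0ℚ ≤ℚ q → p ≤ℚ p + q
p≤p+q {p} {q} 0≤q = subst (_≤ℚ p + q) (ℚ.+-identityʳ p) (ℚ.+-monoʳ-≤ p 0≤q)

0≤× : ∀ {h} n → 0ℚ ≤ℚ h → 0ℚ ≤ℚ n ×ℚ h
0≤× zero    0≤h = ℚ.≤-refl
0≤× (suc n) 0≤h = ℚ.≤-trans 0≤h (p≤p+q (0≤× n 0≤h))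

×-monoˡ-≤ : ∀ {h m n} → 0ℚ ≤ℚ h → m ≤ n → m ×ℚ h ≤ℚ n ×ℚ h
×-monoˡ-≤ {n = n} 0≤h z≤n       = 0≤× n 0≤h
×-monoˡ-≤ {h}     0≤h (s≤s m≤n) = ℚ.+-monoʳ-≤ h (×-monoˡ-≤ 0≤h m≤n)

module _ {A : Set} (f : A → ℚ) {h : ℚ} where

  ×-≤-sum : ∀ xs → (∀ {a} → a ∈ xs → h ≤ℚ f a) → length xs ×ℚ h ≤ℚ foldr _+_ 0ℚ (map f xs)
  ×-≤-sum []       _  = ℚ.≤-refl
  ×-≤-sum (a ∷ xs) h≤ = ℚ.+-mono-≤ (h≤ (here refl)) (×-≤-sum xs (h≤ ∘ there))

  suc×-≤-sum : ∀ xs → (∀ {a} → a ∈ xs → h ≤ℚ f a) → Any (λ a → h + h ≤ℚ f a) xs →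
               suc (length xs) ×ℚ h ≤ℚ foldr _+_ 0ℚ (map f xs)
  suc×-≤-sum (a ∷ xs) h≤ (here 2h≤) =
    subst (_≤ℚ _) (ℚ.+-assoc h h _) (ℚ.+-mono-≤ 2h≤ (×-≤-sum xs (h≤ ∘ there)))
  suc×-≤-sum (a ∷ xs) h≤ (there any) = ℚ.+-mono-≤ (h≤ (here refl)) (suc×-≤-sum xs (h≤ ∘ there) any)

-- share t is (1 - α k) / (2(k - 1)) = (k - 2) / (2k² - 4k + 1) for k = 2 + t.
share : ℕ → ℚ
share t = + t / suc (2 ℕ.* t ℕ.* (2 ℕ.+ t))

module _ (t : ℕ) where

  private
    d a b : ℕ
    d = 2 ℕ.* t ℕ.* (2 ℕ.+ t)
    a = 1 ℕ.+ 2 ℕ.* t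
    b = 2 ℕ.* (1 ℕ.+ t) ℕ.* t

  α-≡ : α (2 ℕ.+ t) ≡ + a / suc d
  α-≡ = ℚ./-cong (cong +_ (trans (cong (_∸ 3) (numerator t)) (ℕ.m+n∸m≡n 3 a)))
                 (cong suc (trans (cong (_∸ 4 ℕ.* (2 ℕ.+ t)) (denominator t))
                                  (ℕ.m+n∸n≡m d (4 ℕ.* (2 ℕ.+ t)))))
    where
      numerator : ∀ t → 2 ℕ.* (2 ℕ.+ t) ≡ 3 ℕ.+ (1 ℕ.+ 2 ℕ.* t)
      numerator = solve-∀
      denominator : ∀ t → 2 ℕ.* (2 ℕ.+ t) ℕ.* (2 ℕ.+ t) ≡ 2 ℕ.* t ℕ.* (2 ℕ.+ t) ℕ.+ 4 ℕ.* (2 ℕ.+ t)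
      denominator = solve-∀

  1-α-≡ : 1ℚ - α (2 ℕ.+ t) ≡ + b / suc d
  1-α-≡ = +≡⇒-≡ (begin
    + b / suc d + α (2 ℕ.+ t)      ≡⟨ cong (_+_ (+ b / suc d)) α-≡ ⟩
    + b / suc d + + a / suc d      ≡⟨ /-+-same b d a ⟩
    + (b ℕ.+ a) / suc d            ≡⟨ /-≡-cross (b ℕ.+ a) d 1 0 (ring-eq t) ⟩
    1ℚ                             ∎)
    where
      open ≡-Reasoning
      ring-eq : ∀ t → (2 ℕ.* (1 ℕ.+ t) ℕ.* t ℕ.+ (1 ℕ.+ 2 ℕ.* t)) ℕ.* 1 ≡
                      1 ℕ.* suc (2 ℕ.* t ℕ.* (2 ℕ.+ t))
      ring-eq = solve-∀

  0≤share : 0ℚ ≤ℚ share t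
  0≤share = /-≤-cross 0 0 t d z≤n

  share+share≤α : share t + share t ≤ℚ α (2 ℕ.+ t)
  share+share≤α = begin
    share t + share t      ≡⟨ /-+-same t d t ⟩
    + (t ℕ.+ t) / suc d    ≤⟨ /-≤-cross (t ℕ.+ t) d a d
                                (ℕ.*-monoˡ-≤ (suc d) (ℕ.<⇒≤ (ℕ.≤-reflexive (ring-eq t)))) ⟩
    + a / suc d            ≡⟨ α-≡ ⟨
    α (2 ℕ.+ t)            ∎
    where
      open ℚ.≤-Reasoning
      ring-eq : ∀ t → suc (t ℕ.+ t) ≡ 1 ℕ.+ 2 ℕ.* t
      ring-eq = solve-∀

  share+share≤1/j : ∀ {j} → 1 ≤ j → j ≤ 2 ℕ.+ t → share t + share t ≤ℚ inv j
  share+share≤1/j {j} 1≤j j≤k = begin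
    share t + share t      ≡⟨ /-+-same t d t ⟩
    + (t ℕ.+ t) / suc d    ≤⟨ /-≤-cross (t ℕ.+ t) d 1 (suc t) (ℕ.<⇒≤ (ℕ.≤-reflexive (ring-eq t))) ⟩
    inv (2 ℕ.+ t)          ≤⟨ inv-antimono 1≤j j≤k ⟩
    inv j                  ∎
    where
      open ℚ.≤-Reasoning
      ring-eq : ∀ t → suc ((t ℕ.+ t) ℕ.* (2 ℕ.+ t)) ≡ 1 ℕ.* suc (2 ℕ.* t ℕ.* (2 ℕ.+ t))
      ring-eq = solve-∀

  share+share≤[1-α]/[j-1] : ∀ {j} → 2 ≤ j → j ≤ 2 ℕ.+ t →
                            share t + share t ≤ℚ (1ℚ - α (2 ℕ.+ t)) * inv (j ∸ 1)
  share+share≤[1-α]/[j-1] {suc (suc j)} (s≤s (s≤s _)) j≤k = begin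
    share t + share t                   ≡⟨ /-+-same t d t ⟩
    + (t ℕ.+ t) / suc d                 ≡⟨ /-*-inv (t ℕ.+ t) d t (ring-eq t) ⟨
    + b / suc d * inv (suc t)           ≤⟨ ℚ.*-monoˡ-≤-nonNeg (+ b / suc d) {{ℚ.normalize-nonNeg b (suc d)}}
                                             (inv-antimono (s≤s z≤n) (ℕ.≤-pred j≤k)) ⟩
    + b / suc d * inv (suc j)           ≡⟨ cong (_* inv (suc j)) 1-α-≡ ⟨
    (1ℚ - α (2 ℕ.+ t)) * inv (suc j)    ∎
    where
      open ℚ.≤-Reasoning
      ring-eq : ∀ t → suc t ℕ.* (t ℕ.+ t) ≡ 2 ℕ.* (1 ℕ.+ t) ℕ.* t
      ring-eq = solve-∀

  share≤1-[j-1]α : ∀ {j} → j ≤ 2 ℕ.+ t → share t ≤ℚ 1ℚ - ℕtoℚ (j ∸ 1) * α (2 ℕ.+ t)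
  share≤1-[j-1]α {j} j≤k = +-≤⇒≤- (begin
    share t + ℕtoℚ (j ∸ 1) * α (2 ℕ.+ t)       ≡⟨ cong (λ α′ → share t + ℕtoℚ (j ∸ 1) * α′) α-≡ ⟩
    share t + ℕtoℚ (j ∸ 1) * (+ a / suc d)     ≡⟨ cong (_+_ (share t)) (ℕtoℚ-*-/ (j ∸ 1) a d) ⟩
    share t + + ((j ∸ 1) ℕ.* a) / suc d        ≡⟨ /-+-same t d ((j ∸ 1) ℕ.* a) ⟩
    + (t ℕ.+ (j ∸ 1) ℕ.* a) / suc d           ≤⟨ /-≤-cross (t ℕ.+ (j ∸ 1) ℕ.* a) d 1 0
                                                   (ℕ.≤-trans numerator≤ (ℕ.≤-reflexive (ring-eq t))) ⟩
    1ℚ                                         ∎)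
    where
      open ℚ.≤-Reasoning
      numerator≤ : (t ℕ.+ (j ∸ 1) ℕ.* a) ℕ.* 1 ≤ (t ℕ.+ (1 ℕ.+ t) ℕ.* a) ℕ.* 1
      numerator≤ = ℕ.*-monoˡ-≤ 1 (ℕ.+-monoʳ-≤ t (ℕ.*-monoˡ-≤ a (ℕ.∸-monoˡ-≤ 1 j≤k)))
      ring-eq : ∀ t → (t ℕ.+ (1 ℕ.+ t) ℕ.* (1 ℕ.+ 2 ℕ.* t)) ℕ.* 1 ≡ 1 ℕ.* suc (2 ℕ.* t ℕ.* (2 ℕ.+ t))
      ring-eq = solve-∀

  bound≡5×share : bound (2 ℕ.+ t) ≡ 5 ×ℚ share t
  bound≡5×share = begin
    ℕtoℚ 5 * (1ℚ - α (2 ℕ.+ t)) * 1/[2k-2]     ≡⟨ ℚ.*-assoc (ℕtoℚ 5) (1ℚ - α (2 ℕ.+ t)) 1/[2k-2] ⟩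
    ℕtoℚ 5 * ((1ℚ - α (2 ℕ.+ t)) * 1/[2k-2])   ≡⟨ cong (λ x → ℕtoℚ 5 * (x * 1/[2k-2])) 1-α-≡ ⟩
    ℕtoℚ 5 * (+ b / suc d * 1/[2k-2])          ≡⟨ cong (ℕtoℚ 5 *_) (/-*-inv t d (t ℕ.+ 1 ℕ.* suc t) (ring-eq t)) ⟩
    ℕtoℚ 5 * share t                          ≡⟨ ℕtoℚ-*-/ 5 t d ⟩
    + (5 ℕ.* t) / suc d                       ≡⟨ ×-/ 5 t d ⟨
    5 ×ℚ share t                              ∎
    where
      open ≡-Reasoning
      1/[2k-2] : ℚ
      1/[2k-2] = inv (2 ℕ.* suc t)
      ring-eq : ∀ t → suc (t ℕ.+ 1 ℕ.* suc t) ℕ.* t ≡ 2 ℕ.* (1 ℕ.+ t) ℕ.* t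
      ring-eq = solve-∀

choice-on : ∀ {A : Set} {P : A → Set} {R : A → A → Set} → Decidable P →
            (∀ {a} → P a → Σ A (R a)) → Σ[ f ∈ (A → A) ] (∀ {a} → P a → R a (f a))
choice-on {A} {P} {R} P? g = f , f-spec
  where
    f : A → A
    f a with P? a
    ... | yes pa = proj₁ (g pa)
    ... | no _   = a
    f-spec : ∀ {a} → P a → R a (f a)
    f-spec {a} pa with P? a
    ... | yes pa′ = proj₂ (g pa′)
    ... | no ¬pa  = contradiction pa ¬pa

if-elim : ∀ {A : Set} (P : A → Set) b {x y} → (b ≡ true → P x) → (b ≡ false → P y) →
          P (if b then x else y)
if-elim P true  p _ = p refl
if-elim P false _ q = q refl

if-dec : ∀ {A B : Set} (P : A → Set) (d : Dec B) {x y} → (B → P x) → (¬ B → P y) →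
         P (if ⌊ d ⌋ then x else y)
if-dec P (yes b) p _ = p b
if-dec P (no ¬b) _ q = q ¬b

1≤classSize : ∀ {n} (c : Fin n → Fin n) v → 1 ≤ classSize c (c v)
1≤classSize {n} c v = ∈-length (∈-filter⁺ (λ u → c u ≟ c v) (∈-allFin v) refl)

module _ {n k} {G : Graph n} (S : StarPartition k G) where

  members : Fin n → List (Fin n)
  members x = filter (λ u → ctr S u ≟ x) (allFin n)

  ∈-members : ∀ {v x} → ctr S v ≡ x → v ∈ members x
  ∈-members {v} = ∈-filter⁺ (λ u → ctr S u ≟ _) (∈-allFin v)

  critical⇒2-star⊎3-center : ∀ {v} → Critical S v → size S (ctr S v) ≡ 2 ⊎ (ctr S v ≡ v × size S v ≡ 3)
  critical⇒2-star⊎3-center {v} crit with size S (ctr S v) ℕ.≟ 2 | ctr S v ≟ v | size S v ℕ.≟ 3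
  ... | yes two | _       | _         = inj₁ two
  ... | no _    | yes c≡v | yes three = inj₂ (c≡v , three)
  ... | no _    | yes _   | no _      = ⊥-elim crit
  ... | no _    | no _    | _         = ⊥-elim crit

  critical⇒size≤3 : ∀ {v} → Critical S v → size S (ctr S v) ≤ 3
  critical⇒size≤3 crit with critical⇒2-star⊎3-center crit
  ... | inj₁ two              = ℕ.≤-trans (ℕ.≤-reflexive two) (ℕ.n≤1+n 2)
  ... | inj₂ (c≡v , three) = ℕ.≤-reflexive (trans (cong (size S) c≡v) three)

  critical-in-3-star⇒center : ∀ {v} → Critical S v → size S (ctr S v) ≡ 3 → ctr S v ≡ v
  critical-in-3-star⇒center crit three with critical⇒2-star⊎3-center crit
  ... | inj₁ two        = contradiction (trans (sym two) three) λ ()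
  ... | inj₂ (c≡v , _) = c≡v

module _ {n k} {G : Graph n} (S Q : StarPartition k G) where

  HasCriticalSatellite : Fin n → Set
  HasCriticalSatellite q = Σ[ w ∈ Fin n ] (ctr Q w ≡ q × w ≢ q × Critical S w)

  satCritical?⇒ : ∀ {q} → satCritical? S Q q ≡ true → HasCriticalSatellite q
  satCritical?⇒ {q} sat with satisfied (any⁻ _ (allFin n) (subst T (sym sat) _))
  ... | w , w-ok with Equivalence.to (T-∧ {⌊ ctr Q w ≟ q ⌋}) w-ok
  ... | w∈q , rest with Equivalence.to (T-∧ {not ⌊ w ≟ q ⌋}) rest
  ... | w≢q , crit = w , toWitness w∈q , toWitnessFalse w≢q , crit

  critical-satellites⇒Op2 : ¬ Op1Applicable S → ∀ {x} → ctr S x ≡ x → size S x ≡ 4 →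
                            (∀ {v} → ctr S v ≡ x → HasCriticalSatellite v) → Op2Applicable S
  critical-satellites⇒Op2 ¬op1 {x} x-center size≡4 has-sat =
    x , x-center , ℕ.≤-trans (ℕ.m≤n+m 2 2) (ℕ.≤-reflexive (sym size≡4)) , ℕ.≤-reflexive size≡4 ,
    w , (λ v v∈x → w-crit v∈x , w∉x v∈x , adj v∈x) , separate
    where
      w : Fin n → Fin n
      w = proj₁ (choice-on (λ v → ctr S v ≟ x) has-sat)

      w-sat : ∀ {v} → ctr S v ≡ x → ctr Q (w v) ≡ v × w v ≢ v × Critical S (w v)
      w-sat = proj₂ (choice-on (λ v → ctr S v ≟ x) has-sat)

      w-crit : ∀ {v} → ctr S v ≡ x → Critical S (w v)
      w-crit = proj₂ ∘ proj₂ ∘ w-sat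

      4≤size : ∀ {v} → ctr S v ≡ x → 4 ≤ size S (ctr S v)
      4≤size v∈x = ℕ.≤-reflexive (sym (trans (cong (size S) v∈x) size≡4))

      w∉x : ∀ {v} → ctr S v ≡ x → ctr S (w v) ≢ x
      w∉x v∈x w∈x = ℕ.≤⇒≯ (critical⇒size≤3 S (w-crit v∈x)) (4≤size w∈x)

      adj : ∀ {v} → ctr S v ≡ x → Adj G v (w v)
      adj {v} v∈x =
        let w∈v , w≢v , _ = w-sat v∈x
        in symm G (subst (Adj G (w v)) w∈v (ctr-adj Q (w v) (λ w-center → w≢v (trans (sym w-center) w∈v))))

      satellite-partner-is-3-center : ∀ {v} → ctr S v ≡ x → v ≢ x → ctr S (w v) ≡ w v × size S (w v) ≡ 3
      satellite-partner-is-3-center {v} v∈x v≢x with critical⇒2-star⊎3-center S (w-crit v∈x)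
      ... | inj₂ center = center
      ... | inj₁ two    = contradiction
        (w v , v , symm G (adj v∈x) , two , (λ v-center → v≢x (trans (sym v-center) v∈x)) , 4≤size v∈x) ¬op1

      separate-from-satellite : ∀ {v v′} → ctr S v ≡ x → ctr S v′ ≡ x → v ≢ v′ → v ≢ x →
                                ctr S (w v) ≢ ctr S (w v′)
      separate-from-satellite {v} {v′} v∈x v′∈x v≢v′ v≢x same = v≢v′ (begin
        v             ≡⟨ sym (proj₁ (w-sat v∈x)) ⟩
        ctr Q (w v)   ≡⟨ cong (ctr Q) w≡w′ ⟩
        ctr Q (w v′)  ≡⟨ proj₁ (w-sat v′∈x) ⟩
        v′            ∎)
        where
          open ≡-Reasoning
          w-center = proj₁ (satellite-partner-is-3-center v∈x v≢x)
          w-size   = proj₂ (satellite-partner-is-3-center v∈x v≢x)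
          w′∈w : ctr S (w v′) ≡ w v
          w′∈w = trans (sym same) w-center
          w≡w′ : w v ≡ w v′
          w≡w′ = trans (sym w′∈w)
            (critical-in-3-star⇒center S (w-crit v′∈x) (trans (cong (size S) w′∈w) w-size))

      separate : ∀ v v′ → ctr S v ≡ x → ctr S v′ ≡ x → v ≢ v′ → ctr S (w v) ≢ ctr S (w v′)
      separate v v′ v∈x v′∈x v≢v′ with v ≟ x
      ... | no v≢x   = separate-from-satellite v∈x v′∈x v≢v′ v≢x
      ... | yes refl = separate-from-satellite v′∈x v∈x (v≢v′ ∘ sym) (v≢v′ ∘ sym) ∘ sym

module _ {n t} {G : Graph n} (S Q : StarPartition (2 ℕ.+ t) G) where

  token-≥ : ∀ v → share t + share t ≤ℚ token S Q v ⊎ (share t ≤ℚ token S Q v × HasCriticalSatellite S Q v)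
  token-≥ v =
    if-dec P (j ℕ.≟ 1) (λ _ → inj₁ (share+share≤α t)) λ j≢1 →
    if-elim P (critical? S q)
      (λ _ → if-dec P (v ≟ q) (λ _ → inj₁ (share+share≤α t))
                              (λ _ → inj₁ (share+share≤[1-α]/[j-1] t (2≤j j≢1) j≤k)))
      (λ _ → if-elim P (satCritical? S Q q)
        (λ sat → if-dec P (v ≟ q)
          (λ v≡q → inj₂ (share≤1-[j-1]α t j≤k ,
                         subst (HasCriticalSatellite S Q) (sym v≡q) (satCritical?⇒ S Q sat)))
          (λ _ → inj₁ (share+share≤α t)))
        (λ _ → inj₁ (share+share≤1/j t 1≤j j≤k)))
    where
      q = ctr Q v
      j = size Q q
      1≤j : 1 ≤ j
      1≤j = 1≤classSize (ctr Q) v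
      2≤j : j ≢ 1 → 2 ≤ j
      2≤j j≢1 = ℕ.≤∧≢⇒< 1≤j (j≢1 ∘ sym)
      j≤k : j ≤ 2 ℕ.+ t
      j≤k = size-≤ Q q
      P : ℚ → Set
      P τ = share t + share t ≤ℚ τ ⊎ (share t ≤ℚ τ × HasCriticalSatellite S Q v)

  share≤token : ∀ v → share t ≤ℚ token S Q v
  share≤token v = [ ℚ.≤-trans (p≤p+q (0≤share t)) , proj₁ ]′ (token-≥ v)

  4-star-has-double-share : ¬ Op1Applicable S → ¬ Op2Applicable S → ∀ {x} → ctr S x ≡ x → size S x ≡ 4 →
                            Any (λ v → share t + share t ≤ℚ token S Q v) (members S x)
  4-star-has-double-share ¬op1 ¬op2 {x} x-center size≡4 =
    by-search (any? (λ v → share t + share t ℚ.≤? token S Q v) (members S x))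
    where
      by-search : Dec (Any (λ v → share t + share t ≤ℚ token S Q v) (members S x)) →
                  Any (λ v → share t + share t ≤ℚ token S Q v) (members S x)
      by-search (yes some) = some
      by-search (no none)  = contradiction (critical-satellites⇒Op2 S Q ¬op1 x-center size≡4 has-sat) ¬op2
        where
          has-sat : ∀ {v} → ctr S v ≡ x → HasCriticalSatellite S Q v
          has-sat {v} v∈x =
            [ (λ double → contradiction (lose (∈-members S v∈x) double) none) , proj₂ ]′ (token-≥ v)

  starToken-≥ : ¬ Op1Applicable S → ¬ Op2Applicable S → ∀ {x} → ctr S x ≡ x → 4 ≤ size S x →
                5 ×ℚ share t ≤ℚ starToken S Q x
  starToken-≥ ¬op1 ¬op2 {x} x-center 4≤size = by-size (size S x ℕ.≟ 4)
    where
      by-size : Dec (size S x ≡ 4) → 5 ×ℚ share t ≤ℚ starToken S Q x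
      by-size (no size≢4)  = ℚ.≤-trans (×-monoˡ-≤ (0≤share t) (ℕ.≤∧≢⇒< 4≤size (size≢4 ∘ sym)))
                                       (×-≤-sum (token S Q) (members S x) λ _ → share≤token _)
      by-size (yes size≡4) = subst (λ m → suc m ×ℚ share t ≤ℚ starToken S Q x) size≡4
        (suc×-≤-sum (token S Q) (members S x) (λ _ → share≤token _)
                    (4-star-has-double-share ¬op1 ¬op2 x-center size≡4))

lemma7 : ∀ {n : ℕ} (k : ℕ) → 4 ≤ k → (G : Graph n) (S Q : StarPartition k G)
           → MinOneStars S → NoOperationApplicable S → Optimal Q
           → ∀ x → ctr S x ≡ x → 4 ≤ size S x
           → bound k ≤ℚ starToken S Q x
lemma7 (suc (suc t)) (s≤s (s≤s _)) G S Q _ (¬op1 , ¬op2 , _) _ x x-center 4≤size =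
  subst (_≤ℚ starToken S Q x) (sym (bound≡5×share t)) (starToken-≥ S Q ¬op1 ¬op2 x-center 4≤size)
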